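{- Let $G=(V,E)$ be a finite graph and $\ell\ge 0$ an integer. A set $S\subseteq V$ is an $\ell$-forcing set of $G$ if and only if $S$ intersects every $\ell$-forcing fort of $G$.
   Context: Color-change rule (zero forcing): given a set of colored vertices, a colored vertex with exactly one uncolored neighbor colors ("forces") that neighbor. Leaks: for a set $L\subseteq V$, placing a leak on each $v\in L$ means attaching to $v$ one new pendant vertex (adjacent only to $v$) which is never initially colored; consequently no vertex of $L$ can ever force a vertex of $V$. A set $S\subseteq V$ is an $\ell$-forcing set if for every $L\subseteq V$ with $|L|\le \ell$, starting with exactly the vertices of $S$ colored and repeatedly applying the color-change rule in the graph with leaks on $L$, every vertex of $V$ eventually becomes colored. A nonempty set $T\subseteq V$ is an $\ell$-forcing fort if there exist $S', L\subseteq V$ with $|L|\le\ell$ such that, when $S'$ is initially colored and the vertices of $L$ have leaks, the set of vertices of $V$ that remain uncolored after applying the color-change rule as long as possible is exactly $T$. -}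

module Defs where

open import Data.Nat using (ℕ; _≤_)
open import Data.Bool using (Bool; true; false)
open import Data.Fin using (Fin)
open import Data.Fin.Subset using (Subset; _∈_; _∉_; ∣_∣)
open import Data.Product using (Σ; ∃; _×_)
open import Relation.Binary.PropositionalEquality using (_≡_; _≢_)
open import Relation.Nullary using (¬_)
open import Function.Bundles using (_⇔_)

record Graph (n : ℕ) : Set where
  field
    adj       : Fin n → Fin n → Bool
    adj-sym   : ∀ u v → adj u v ≡ adj v u
    adj-irrefl : ∀ v → adj v v ≡ false

open Graph public

Adj : ∀ {n} → Graph n → Fin n → Fin n → Set
Adj G u v = adj G u v ≡ true

-- Colored G S L v : vertex v of V is colored at the end of the zero forcing
-- process started from S, with leaks on the vertices of L.
-- (Least set containing S and closed under the color-change rule; a vertex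
-- u ∈ L has a pendant leak neighbour that is never initially colored, so it
-- can never force a vertex of V.)
data Colored {n : ℕ} (G : Graph n) (S L : Subset n) : Fin n → Set where
  init  : ∀ {v} → v ∈ S → Colored G S L v
  force : ∀ {u v} → Colored G S L u → u ∉ L → Adj G u v →
          (∀ w → Adj G u w → w ≢ v → Colored G S L w) →
          Colored G S L v

IsForcingSet : ∀ {n} → Graph n → ℕ → Subset n → Set
IsForcingSet {n} G ℓ S = ∀ (L : Subset n) → ∣ L ∣ ≤ ℓ → ∀ v → Colored G S L v

IsForcingFort : ∀ {n} → Graph n → ℕ → Subset n → Set
IsForcingFort {n} G ℓ T =
  (∃ λ v → v ∈ T) ×
  Σ (Subset n) (λ S' → Σ (Subset n) (λ L →
    (∣ L ∣ ≤ ℓ) × (∀ v → (v ∈ T) ⇔ (¬ Colored G S' L v))))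

Intersects : ∀ {n} → Subset n → Subset n → Set
Intersects S T = ∃ λ v → (v ∈ S) × (v ∈ T)

module Submission where

-- The vertices colored from S with leaks on L form the least set containing S
-- that is closed under the color-change rule; saturating S under the rule
-- computes it, so being colored is decidable.  Moreover coloring is
-- transitive: whatever S colors is colored by any S' that colors all of S.
--
-- If S is ℓ-forcing and T is the fort left uncolored by S' with leaks on L,
-- then were S disjoint from T, every vertex of S would be colored from S'
-- and hence so would everything S colors, i.e. all of V, contradicting T ≠ ∅.
-- Conversely, if S meets every ℓ-forcing fort and some v stayed uncolored
-- from S with leaks on L, the uncolored set would be a fort containing v,
-- so it would meet S; but vertices of S are colored.

open import Defs
open import Data.Nat using (ℕ; zero; suc; _+_; _≤_; _<_)
open import Data.Nat.Properties using (≤-trans; +-suc; +-monoʳ-≤; m≤m+n; <⇒≱; module ≤-Reasoning)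
import Data.Bool as Bool
open import Data.Fin using (Fin)
import Data.Fin as Fin
open import Data.Fin.Subset using (Subset; _∈_; _∉_; _⊆_; ∣_∣; _∪_; ⁅_⁆)
open import Data.Fin.Subset.Properties
  using (_∈?_; ∣p∣≤n; p⊂q⇒∣p∣<∣q∣; p⊆p∪q; q⊆p∪q; x∈p∪q⁻; x∈⁅x⁆; x∈⁅y⁆⇒x≡y)
open import Data.Fin.Properties using (any?; all?)
open import Data.Vec.Base using (tabulate)
open import Data.Vec.Properties using (lookup∘tabulate; []=⇒lookup; lookup⇒[]=)
open import Data.Product using (Σ; ∃; _×_; _,_)
open import Data.Sum using (_⊎_; inj₁; inj₂)
open import Data.Empty using (⊥-elim)
open import Level using (Level)
open import Function.Base using (id; _∘_)
open import Function.Bundles using (_⇔_; mk⇔; Equivalence)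
open Equivalence using (to; from)
open import Relation.Binary.PropositionalEquality using (_≢_; trans; sym; subst)
open import Relation.Nullary using (¬_; Dec; yes; no; does)
open import Relation.Nullary.Decidable
  using (_×-dec_; _→-dec_; ¬?; map′; decidable-stable)
open import Relation.Unary using (Pred; Decidable)

private
  variable
    n : ℕ
    p : Level

subsetOf : {P : Pred (Fin n) p} → Decidable P → Subset n
subsetOf P? = tabulate (does ∘ P?)

∈-subsetOf : {P : Pred (Fin n) p} (P? : Decidable P) (x : Fin n) → x ∈ subsetOf P? ⇔ P x
∈-subsetOf P? x with P? x | lookup∘tabulate (does ∘ P?) x
... | yes Px | eq = mk⇔ (λ _ → Px) (λ _ → lookup⇒[]= x _ eq)
... | no ¬Px | eq = mk⇔ (λ x∈ → ⊥-elim (true≢false (trans (sym ([]=⇒lookup x∈)) eq))) (⊥-elim ∘ ¬Px)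
  where
    true≢false : Bool.true ≢ Bool.false
    true≢false ()

∣p∣<∣p∪⁅x⁆∣ : {p : Subset n} {x : Fin n} → x ∉ p → ∣ p ∣ < ∣ p ∪ ⁅ x ⁆ ∣
∣p∣<∣p∪⁅x⁆∣ {p = p} {x} x∉p = p⊂q⇒∣p∣<∣q∣ (p⊆p∪q ⁅ x ⁆ , x , q⊆p∪q p ⁅ x ⁆ (x∈⁅x⁆ x) , x∉p)

module _ (G : Graph n) (L : Subset n) where

  ForcedBy : Subset n → Fin n → Set
  ForcedBy C v = ∃ λ u → u ∈ C × u ∉ L × Adj G u v × (∀ w → Adj G u w → w ≢ v → w ∈ C)

  forcedBy? : ∀ C v → Dec (ForcedBy C v)
  forcedBy? C v = any? λ u →
    u ∈? C ×-dec ¬? (u ∈? L) ×-dec adj G u v Bool.≟ Bool.true ×-dec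
    all? (λ w → adj G u w Bool.≟ Bool.true →-dec ¬? (w Fin.≟ v) →-dec w ∈? C)

  ForcingClosed : Subset n → Set
  ForcingClosed C = ∀ {v} → ForcedBy C v → v ∈ C

  _⊆Colored_ : Subset n → Subset n → Set
  C ⊆Colored S = ∀ {x} → x ∈ C → Colored G S L x

  Colored-least : ∀ {S C v} → S ⊆ C → ForcingClosed C → Colored G S L v → v ∈ C
  Colored-least S⊆C closed (init v∈S) = S⊆C v∈S
  Colored-least S⊆C closed (force {u} col-u u∉L u~v others) =
    closed (u , Colored-least S⊆C closed col-u , u∉L , u~v ,
            λ w u~w w≢v → Colored-least S⊆C closed (others w u~w w≢v))

  Colored-trans : ∀ {S S' v} → S ⊆Colored S' → Colored G S L v → Colored G S' L v
  Colored-trans S⊆col (init v∈S) = S⊆col v∈S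
  Colored-trans S⊆col (force col-u u∉L u~v others) =
    force (Colored-trans S⊆col col-u) u∉L u~v (λ w u~w w≢v → Colored-trans S⊆col (others w u~w w≢v))

  forcedBy-colored : ∀ {S C v} → C ⊆Colored S → ForcedBy C v → Colored G S L v
  forcedBy-colored C⊆col (u , u∈C , u∉L , u~v , others) =
    force (C⊆col u∈C) u∉L u~v (λ w u~w w≢v → C⊆col (others w u~w w≢v))

  closed-or-forces : ∀ C → ForcingClosed C ⊎ ∃ λ v → v ∉ C × ForcedBy C v
  closed-or-forces C with any? (λ v → ¬? (v ∈? C) ×-dec forcedBy? C v)
  ... | yes forces = inj₂ forces
  ... | no ¬forces = inj₁ closed
    where
      closed : ForcingClosed C
      closed {v} forced = decidable-stable (v ∈? C) λ v∉C → ¬forces (v , v∉C , forced)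

  forcing-closure : ∀ {S} k C → S ⊆ C → C ⊆Colored S → n ≤ k + ∣ C ∣ →
                    Σ (Subset n) λ D → S ⊆ D × D ⊆Colored S × ForcingClosed D
  forcing-closure k C S⊆C C⊆col bound with closed-or-forces C | k
  ... | inj₁ closed              | _     = C , S⊆C , C⊆col , closed
  ... | inj₂ (v , v∉C , forced) | zero  =
    ⊥-elim (<⇒≱ (∣p∣<∣p∪⁅x⁆∣ v∉C) (≤-trans (∣p∣≤n (C ∪ ⁅ v ⁆)) bound))
  ... | inj₂ (v , v∉C , forced) | suc k =
    forcing-closure k (C ∪ ⁅ v ⁆) (p⊆p∪q ⁅ v ⁆ ∘ S⊆C) C∪v⊆col bound′
    where
      C∪v⊆col : (C ∪ ⁅ v ⁆) ⊆Colored _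
      C∪v⊆col {x} x∈ with x∈p∪q⁻ C ⁅ v ⁆ x∈
      ... | inj₁ x∈C = C⊆col x∈C
      ... | inj₂ x∈v = subst (Colored G _ L) (sym (x∈⁅y⁆⇒x≡y v x∈v)) (forcedBy-colored C⊆col forced)
      bound′ : n ≤ k + ∣ C ∪ ⁅ v ⁆ ∣
      bound′ = begin
        n                  ≤⟨ bound ⟩
        suc k + ∣ C ∣       ≡⟨ +-suc k ∣ C ∣ ⟨
        k + suc ∣ C ∣       ≤⟨ +-monoʳ-≤ k (∣p∣<∣p∪⁅x⁆∣ v∉C) ⟩
        k + ∣ C ∪ ⁅ v ⁆ ∣   ∎
        where open ≤-Reasoning

  colored? : ∀ S v → Dec (Colored G S L v)
  colored? S v with forcing-closure n S id init (m≤m+n n ∣ S ∣)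
  ... | C , S⊆C , C⊆col , closed = map′ C⊆col (Colored-least S⊆C closed) (v ∈? C)

uncolored : (G : Graph n) (S L : Subset n) → Subset n
uncolored G S L = subsetOf (¬? ∘ colored? G L S)

∈-uncolored : ∀ (G : Graph n) S L x → x ∈ uncolored G S L ⇔ (¬ Colored G S L x)
∈-uncolored G S L = ∈-subsetOf (¬? ∘ colored? G L S)

uncolored-fort : ∀ (G : Graph n) ℓ S L {v} → ∣ L ∣ ≤ ℓ → ¬ Colored G S L v →
                 IsForcingFort G ℓ (uncolored G S L)
uncolored-fort G ℓ S L {v} |L|≤ℓ v-uncolored =
  (v , from (∈-uncolored G S L v) v-uncolored) , S , L , |L|≤ℓ , ∈-uncolored G S L

intersects? : ∀ (S T : Subset n) → Dec (Intersects S T)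
intersects? S T = any? λ x → x ∈? S ×-dec x ∈? T

forcingSet⇒meetsForts : ∀ (G : Graph n) ℓ S → IsForcingSet G ℓ S →
                        ∀ T → IsForcingFort G ℓ T → Intersects S T
forcingSet⇒meetsForts G ℓ S forcing T ((v , v∈T) , S' , L , |L|≤ℓ , T-uncolored) =
  decidable-stable (intersects? S T) λ disjoint →
    to (T-uncolored v) v∈T (Colored-trans G L (S⊆colored disjoint) (forcing L |L|≤ℓ v))
  where
    S⊆colored : ¬ Intersects S T → ∀ {x} → x ∈ S → Colored G S' L x
    S⊆colored disjoint {x} x∈S = decidable-stable (colored? G L S' x) λ x-uncolored →
      disjoint (x , x∈S , from (T-uncolored x) x-uncolored)

meetsForts⇒forcingSet : ∀ (G : Graph n) ℓ S → (∀ T → IsForcingFort G ℓ T → Intersects S T) →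
                        IsForcingSet G ℓ S
meetsForts⇒forcingSet G ℓ S meets L |L|≤ℓ v =
  decidable-stable (colored? G L S v) λ v-uncolored →
    let (x , x∈S , x∈T) = meets (uncolored G S L) (uncolored-fort G ℓ S L |L|≤ℓ v-uncolored)
    in to (∈-uncolored G S L x) x∈T (init x∈S)

proposition8 : ∀ {n : ℕ} (G : Graph n) (ℓ : ℕ) (S : Subset n) →
    IsForcingSet G ℓ S ⇔ (∀ (T : Subset n) → IsForcingFort G ℓ T → Intersects S T)
proposition8 G ℓ S = mk⇔ (forcingSet⇒meetsForts G ℓ S) (meetsForts⇒forcingSet G ℓ S)
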